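{- Let $n\ge1$ and let $S$ be an admissible subset of $\{r,b,g,y,o,s\}$ with $g\in S$. Then there is a bijection between $X_n(S)$ and $J(T_n(S))$ such that for $x\in X_n(S)$ corresponding to $I\in J(T_n(S))$, the sum of the entries of $x$ equals $|I|$.
   Context: For an integer $n\ge1$, let $T_n$ be the set of triples $(c_1,c_2,c_3)$ of nonnegative integers with $c_1+c_2+c_3\le n-2$. Six colors are associated to vectors: red $r=(1,0,0)$, green $g=(0,1,0)$, yellow $y=(0,0,1)$, blue $b=(-1,1,0)$, orange $o=(-1,0,1)$, silver $s=(0,1,-1)$. For $S\subseteq\{r,b,g,o,y,s\}$, $T_n(S)$ is the poset on $T_n$ whose order relation is the reflexive–transitive closure of the relations $u<u+v$ for all $u,u+v\in T_n$ and $v$ the vector of a color in $S$. $S$ is admissible if: $\{r,b\}\subseteq S\Rightarrow g\in S$; $\{o,s\}\subseteq S\Rightarrow b\in S$; $\{s,y\}\subseteq S\Rightarrow g\in S$; $\{r,o\}\subseteq S\Rightarrow y\in S$. $J(P)$ is the set of order ideals of a poset $P$. For admissible $S$ with $g\in S$, $X_n(S)$ is the set of integer arrays $x=(x_{i,j})$ indexed by $1\le i\le n-1$, $1\le j\le n-i$ (staircase shape), with $0\le x_{i,j}\le j$ for all entries, and satisfying, whenever both entries involved are defined, the following conditions for the colors in $S$: orange: $x_{i,j}\le x_{i+1,j}$; red: $x_{i,j}\le x_{i-1,j+1}$; yellow: $x_{i,j}\le x_{i,j+1}$; blue: $x_{i,j}\le x_{i+1,j-1}+1$; silver: $x_{i,j}\le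 x_{i,j-1}+1$. -}

module Defs where

open import Data.Bool using (Bool; true; false; if_then_else_)
open import Data.Nat using (ℕ; zero; suc; _+_; _≤_; _≤?_)
open import Data.Product using (Σ; _×_; _,_; proj₁)
open import Relation.Nullary using (Dec; yes; no; does)
open import Relation.Nullary.Decidable using (_×-dec_)
open import Relation.Binary.Bundles using (Setoid)
open import Relation.Binary.Structures using (IsEquivalence)
open import Relation.Binary.PropositionalEquality using (_≡_; refl; sym; trans)
open import Relation.Binary.Construct.Closure.ReflexiveTransitive using (Star)
open import Level using (0ℓ)

data Color : Set where
  r g y b o s : Color

ColorSet : Set
ColorSet = Color → Bool

_∈S_ : Color → ColorSet → Set
c ∈S S = S c ≡ true

Admissible : ColorSet → Set
Admissible S =
    (r ∈S S → b ∈S S → g ∈S S)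
  × (o ∈S S → s ∈S S → b ∈S S)
  × (s ∈S S → y ∈S S → g ∈S S)
  × (r ∈S S → o ∈S S → y ∈S S)

Triple : Set
Triple = ℕ × ℕ × ℕ

-- (c1,c2,c3) ∈ T_n  iff  c1 + c2 + c3 ≤ n - 2 (integer subtraction),
-- i.e. c1 + c2 + c3 + 2 ≤ n.
InT : ℕ → Triple → Set
InT n (c₁ , c₂ , c₃) = c₁ + c₂ + c₃ + 2 ≤ n

-- Step S u w : w = u + v for the vector v of some colour in S
-- (written out coordinatewise on ℕ, the vectors being
--  r=(1,0,0), g=(0,1,0), y=(0,0,1), b=(-1,1,0), o=(-1,0,1), s=(0,1,-1)).
data Step (S : ColorSet) : Triple → Triple → Set where
  step-r : ∀ {a c d} → r ∈S S → Step S (a , c , d) (suc a , c , d)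
  step-g : ∀ {a c d} → g ∈S S → Step S (a , c , d) (a , suc c , d)
  step-y : ∀ {a c d} → y ∈S S → Step S (a , c , d) (a , c , suc d)
  step-b : ∀ {a c d} → b ∈S S → Step S (suc a , c , d) (a , suc c , d)
  step-o : ∀ {a c d} → o ∈S S → Step S (suc a , c , d) (a , c , suc d)
  step-s : ∀ {a c d} → s ∈S S → Step S (a , c , suc d) (a , suc c , d)

StepT : ℕ → ColorSet → Triple → Triple → Set
StepT n S u w = InT n u × InT n w × Step S u w

_⊑[_,_]_ : Triple → ℕ → ColorSet → Triple → Set
u ⊑[ n , S ] w = Star (StepT n S) u w

record Ideal (n : ℕ) (S : ColorSet) : Set where
  field
    mem        : Triple → Bool
    support    : ∀ t → mem t ≡ true → InT n t
    downClosed : ∀ u w → u ⊑[ n , S ] w → mem w ≡ true → mem u ≡ true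
open Ideal public

sumTo : ℕ → (ℕ → ℕ) → ℕ
sumTo zero    f = 0
sumTo (suc k) f = f k + sumTo k f

-- |I| : every element (c1,c2,c3) of T_n has c1,c2,c3 < n.
size : ∀ {n S} → Ideal n S → ℕ
size {n} I = sumTo n λ a → sumTo n λ c → sumTo n λ d →
  if mem I (a , c , d) then 1 else 0

_≈J_ : ∀ {n S} → Ideal n S → Ideal n S → Set
I ≈J I′ = ∀ t → mem I t ≡ mem I′ t

JSetoid : ℕ → ColorSet → Setoid 0ℓ 0ℓ
JSetoid n S = record
  { Carrier = Ideal n S
  ; _≈_ = _≈J_
  ; isEquivalence = record
    { refl = λ t → refl
    ; sym = λ p t → sym (p t)
    ; trans = λ p q t → trans (p t) (q t) } }

Valid : ℕ → ℕ → ℕ → Set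
Valid n i j = 1 ≤ i × 1 ≤ j × i + j ≤ n

valid? : ∀ n i j → Dec (Valid n i j)
valid? n i j = (1 ≤? i) ×-dec ((1 ≤? j) ×-dec (i + j ≤? n))

Array : Set
Array = ℕ → ℕ → ℕ

record InX (n : ℕ) (S : ColorSet) (x : Array) : Set where
  field
    bound  : ∀ i j → Valid n i j → x i j ≤ j
    orange : o ∈S S → ∀ i j → Valid n i j → Valid n (suc i) j →
             x i j ≤ x (suc i) j
    -- x_{i,j} ≤ x_{i-1,j+1}, written with i := i+1
    red    : r ∈S S → ∀ i j → Valid n (suc i) j → Valid n i (suc j) →
             x (suc i) j ≤ x i (suc j)
    yellow : y ∈S S → ∀ i j → Valid n i j → Valid n i (suc j) →
             x i j ≤ x i (suc j)
    -- x_{i,j} ≤ x_{i+1,j-1} + 1, written with j := j+1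
    blue   : b ∈S S → ∀ i j → Valid n i (suc j) → Valid n (suc i) j →
             x i (suc j) ≤ x (suc i) j + 1
    -- x_{i,j} ≤ x_{i,j-1} + 1, written with j := j+1
    silver : s ∈S S → ∀ i j → Valid n i (suc j) → Valid n i j →
             x i (suc j) ≤ x i j + 1

X : ℕ → ColorSet → Set
X n S = Σ Array (InX n S)

-- sum of the entries of x (over the staircase indices; all have i,j ≤ n)
weight : ℕ → Array → ℕ
weight n x = sumTo (suc n) λ i → sumTo (suc n) λ j →
  if does (valid? n i j) then x i j else 0

_≈X_ : ∀ {n S} → X n S → X n S → Set
_≈X_ {n} x x′ = ∀ i j → Valid n i j → proj₁ x i j ≡ proj₁ x′ i j

XSetoid : ℕ → ColorSet → Setoid 0ℓ 0ℓ
XSetoid n S = record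
  { Carrier = X n S
  ; _≈_ = _≈X_
  ; isEquivalence = record
    { refl = λ i j v → refl
    ; sym = λ p i j v → sym (p i j v)
    ; trans = λ p q i j v → trans (p i j v) (q i j v) } }

-- The box (a , c , d) of T_n is the (c+1)-st box of a column standing on the
-- cell (a + 1 , n - a - 1 - d) of the staircase.  An array x then describes the
-- set of boxes lying below the heights x_{i,j}, and each colour condition on x
-- says precisely that this set is closed under the covering relations of that
-- colour; closure under the green ones means every order ideal of T_n(S) is a
-- union of bottom segments of columns, so it is recovered from the array of
-- their heights.  The number of boxes in a column is the entry it stands on,
-- which gives the weight identity.
module Submission where

open import Data.Bool using (Bool; true; false; if_then_else_)
open import Data.Nat
open import Data.Nat.Properties
open import Data.Nat.Tactic.RingSolver using (solve-∀)
open import Data.Product using (Σ; _×_; _,_; proj₁)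
open import Function.Base using (_∘_)
open import Function.Bundles using (Bijection; Inverse; Equivalence; _⇔_; mk⇔)
open import Function.Properties.Inverse using (Inverse⇒Bijection)
open import Relation.Binary.PropositionalEquality
open import Relation.Binary.Construct.Closure.ReflexiveTransitive using (ε; _◅_)
open import Relation.Nullary using (Dec; yes; no; does; ¬_; contradiction)
open import Relation.Nullary.Decidable using (_×-dec_; dec-true; dec-false; does-⇔)

open import Defs

open Equivalence using (to; from)

∸-suc : ∀ {m n} → n < m → m ∸ n ≡ suc (m ∸ suc n)
∸-suc {suc m} {zero}  _         = refl
∸-suc {suc m} {suc n} (s<s n<m) = ∸-suc n<m

m<o∸n⇒n<o : ∀ {m n o} → m < o ∸ n → n < o
m<o∸n⇒n<o {m} lt = m∸n≢0⇒n<m λ eq → contradiction (subst (m <_) eq lt) λ ()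

m<o∸n⇒m+n<o : ∀ {m n o} → m < o ∸ n → m + n < o
m<o∸n⇒m+n<o {m} lt = m≤o∸n⇒m+n≤o (suc m) (<⇒≤ (m<o∸n⇒n<o lt)) lt

m+n<o⇒m<o∸n : ∀ {m n o} → m + n < o → m < o ∸ n
m+n<o⇒m<o∸n {m} = m+n≤o⇒m≤o∸n (suc m)

lowerSet-⊆⇒≤ : ∀ {p q} → (∀ c → c < p → c < q) → p ≤ q
lowerSet-⊆⇒≤ {zero}  _ = z≤n
lowerSet-⊆⇒≤ {suc p} h = h p ≤-refl

lowerSet-⊆⇒≤+1 : ∀ {p q} → (∀ c → suc c < p → c < q) → p ≤ q + 1
lowerSet-⊆⇒≤+1 {q = q} h rewrite +-comm q 1 =
  lowerSet-⊆⇒≤ λ { zero _ → z<s ; (suc c) lt → s<s (h c lt) }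

sumTo-cong : ∀ m {f h : ℕ → ℕ} → (∀ k → k < m → f k ≡ h k) → sumTo m f ≡ sumTo m h
sumTo-cong zero    _   = refl
sumTo-cong (suc m) f≗h = cong₂ _+_ (f≗h m ≤-refl) (sumTo-cong m λ k k<m → f≗h k (m<n⇒m<1+n k<m))

sumTo-truncate : ∀ {L N} (f : ℕ → ℕ) → L ≤ N → (∀ k → L ≤ k → f k ≡ 0) → sumTo N f ≡ sumTo L f
sumTo-truncate {L} f L≤N vanish = go (≤⇒≤′ L≤N)
  where
  go : ∀ {N} → L ≤′ N → sumTo N f ≡ sumTo L f
  go ≤′-refl                    = refl
  go (≤′-step {N} L≤′N) rewrite vanish N (≤′⇒≤ L≤′N) = go L≤′N

sumTo-+ : ∀ m (f h : ℕ → ℕ) → sumTo m (λ k → f k + h k) ≡ sumTo m f + sumTo m h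
sumTo-+ zero    f h = refl
sumTo-+ (suc m) f h rewrite sumTo-+ m f h = interchange (f m) (h m) (sumTo m f) (sumTo m h)
  where
  interchange : ∀ p q u v → p + q + (u + v) ≡ p + u + (q + v)
  interchange = solve-∀

sumTo-swap : ∀ m p (f : ℕ → ℕ → ℕ) →
  sumTo m (λ a → sumTo p (f a)) ≡ sumTo p (λ c → sumTo m (λ a → f a c))
sumTo-swap zero    p f = sym (sumTo-truncate {N = p} (λ _ → 0) z≤n λ _ _ → refl)
sumTo-swap (suc m) p f rewrite sumTo-swap m p f = sym (sumTo-+ p (f m) λ c → sumTo m (λ a → f a c))

sumTo-first : ∀ m (f : ℕ → ℕ) → sumTo (suc m) f ≡ f 0 + sumTo m (f ∘ suc)
sumTo-first zero    f = refl
sumTo-first (suc m) f rewrite sumTo-first m f = +-left-comm (f (suc m)) (f 0) (sumTo m (f ∘ suc))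
  where
  +-left-comm : ∀ p q u → p + (q + u) ≡ q + (p + u)
  +-left-comm = solve-∀

sumTo-reverse : ∀ m (f : ℕ → ℕ) → sumTo m f ≡ sumTo m (λ k → f (m ∸ suc k))
sumTo-reverse zero    f = refl
sumTo-reverse (suc m) f =
  trans (cong (f m +_) (sumTo-reverse m f)) (sym (sumTo-first m λ k → f (suc m ∸ suc k)))

sumTo-reflect : ∀ {m N} (f : ℕ → ℕ) → m ≤ N → f 0 ≡ 0 →
  sumTo N (λ d → f (m ∸ d)) ≡ sumTo m (f ∘ suc)
sumTo-reflect {m} {N} f m≤N f0≡0 = begin
  sumTo N (λ d → f (m ∸ d))             ≡⟨ sumTo-truncate _ m≤N (λ d m≤d → trans (cong f (m≤n⇒m∸n≡0 m≤d)) f0≡0) ⟩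
  sumTo m (λ d → f (m ∸ d))             ≡⟨ sumTo-reverse m _ ⟩
  sumTo m (λ k → f (m ∸ (m ∸ suc k)))   ≡⟨ sumTo-cong m (λ k k<m → cong f (m∸[m∸n]≡n k<m)) ⟩
  sumTo m (f ∘ suc)                     ∎
  where open ≡-Reasoning

sumTo-indicator< : ∀ {v N} → v ≤ N → sumTo N (λ c → if does (c <? v) then 1 else 0) ≡ v
sumTo-indicator< {v} {N} v≤N = begin
  sumTo N (λ c → if does (c <? v) then 1 else 0)
    ≡⟨ sumTo-truncate _ v≤N (λ k v≤k → cong (if_then 1 else 0) (dec-false (k <? v) (≤⇒≯ v≤k))) ⟩
  sumTo v (λ c → if does (c <? v) then 1 else 0)
    ≡⟨ sumTo-cong v (λ k k<v → cong (if_then 1 else 0) (dec-true (k <? v) k<v)) ⟩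
  sumTo v (λ _ → 1)
    ≡⟨ sumTo-ones v ⟩
  v ∎
  where
  open ≡-Reasoning
  sumTo-ones : ∀ m → sumTo m (λ _ → 1) ≡ m
  sumTo-ones zero    = refl
  sumTo-ones (suc m) = cong suc (sumTo-ones m)

prefixLength : (ℕ → Bool) → ℕ → ℕ
prefixLength f zero    = 0
prefixLength f (suc k) = if f 0 then suc (prefixLength (f ∘ suc) k) else 0

DownwardClosed : (ℕ → Bool) → Set
DownwardClosed f = ∀ c → f (suc c) ≡ true → f c ≡ true

prefixLength-≤ : ∀ f k → prefixLength f k ≤ k
prefixLength-≤ f zero = z≤n
prefixLength-≤ f (suc k) with f 0
... | true  = s≤s (prefixLength-≤ (f ∘ suc) k)
... | false = z≤n

prefixLength-sound : ∀ f k {c} → c < prefixLength f k → f c ≡ true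
prefixLength-sound f (suc k) {c} lt with f 0 in f0≡true
prefixLength-sound f (suc k) {zero}  _         | true = f0≡true
prefixLength-sound f (suc k) {suc c} (s<s lt) | true = prefixLength-sound (f ∘ suc) k lt

downwardClosed⇒0 : ∀ {f} → DownwardClosed f → ∀ c → f c ≡ true → f 0 ≡ true
downwardClosed⇒0 closed zero    fc = fc
downwardClosed⇒0 closed (suc c) fc = downwardClosed⇒0 closed c (closed c fc)

prefixLength-complete : ∀ {f} → DownwardClosed f → ∀ {k c} → c < k → f c ≡ true → c < prefixLength f k
prefixLength-complete closed {suc k} {zero} _ fc rewrite fc = z<s
prefixLength-complete closed {suc k} {suc c} (s<s c<k) fc
  rewrite downwardClosed⇒0 closed (suc c) fc = s<s (prefixLength-complete (closed ∘ suc) c<k fc)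

prefixLength-cong : ∀ {f h} → (∀ c → f c ≡ h c) → ∀ k → prefixLength f k ≡ prefixLength h k
prefixLength-cong f≗h zero = refl
prefixLength-cong {h = h} f≗h (suc k) rewrite f≗h 0 =
  cong (λ m → if h 0 then suc m else 0) (prefixLength-cong (f≗h ∘ suc) k)

does⇒ : ∀ {A : Set} (a? : Dec A) → does a? ≡ true → A
does⇒ (yes a) _  = a
does⇒ (no _)  ()

does≡ : ∀ {A : Set} {v} (a? : Dec A) → A ⇔ (v ≡ true) → does a? ≡ v
does≡ {v = true}  a? A⇔v = dec-true a? (from A⇔v refl)
does≡ {v = false} a? A⇔v = dec-false a? λ a → contradiction (to A⇔v a) λ ()

-- The box (a , c , d) stands on the cell (a + 1 , mirror n a d).  The definition
-- is opaque so that unification can read n, a and d off  mirror n a d.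
opaque
  mirror : ℕ → ℕ → ℕ → ℕ
  mirror n a d = n ∸ suc a ∸ d

opaque
  unfolding mirror

  mirror-involutive : ∀ {n a k} → k ≤ n ∸ suc a → mirror n a (mirror n a k) ≡ k
  mirror-involutive = m∸[m∸n]≡n

  mirror-suc : ∀ {n a d} → d < n ∸ suc a → mirror n a d ≡ suc (mirror n a (suc d))
  mirror-suc = ∸-suc

  mirror-shift : ∀ n a d → mirror n (suc a) d ≡ mirror n a (suc d)
  mirror-shift n a d = begin
    n ∸ suc (suc a) ∸ d     ≡⟨ ∸-+-assoc n (suc (suc a)) d ⟩
    n ∸ (suc (suc a) + d)   ≡⟨ cong (n ∸_) (+-suc (suc a) d) ⟨
    n ∸ (suc a + suc d)     ≡⟨ ∸-+-assoc n (suc a) (suc d) ⟨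
    n ∸ suc a ∸ suc d       ∎
    where open ≡-Reasoning

  mirror≤ : ∀ n a d → mirror n a d ≤ n ∸ suc a
  mirror≤ n a d = m∸n≤m (n ∸ suc a) d

  <mirror⇒depth< : ∀ {n a c d} → c < mirror n a d → d < n ∸ suc a
  <mirror⇒depth< {n} {a} {c} {d} = m<o∸n⇒n<o {c} {d} {n ∸ suc a}

  inT⇔ : ∀ {n} a c d → InT n (a , c , d) ⇔ c < mirror n a d
  inT⇔ {n} a c d = mk⇔
    (λ t → m+n<o⇒m<o∸n (m+n<o⇒m<o∸n (subst (_≤ n) (shape a c d) t)))
    (λ lt → subst (_≤ n) (sym (shape a c d)) (m<o∸n⇒m+n<o (m<o∸n⇒m+n<o lt)))
    where
    shape : ∀ a c d → a + c + d + 2 ≡ suc (c + d + suc a)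
    shape = solve-∀

  sumTo-mirror : ∀ {n a} (f : ℕ → ℕ) → f 0 ≡ 0 →
    sumTo n (λ d → f (mirror n a d)) ≡ sumTo (n ∸ suc a) (f ∘ suc)
  sumTo-mirror {n} {a} f = sumTo-reflect f (m∸n≤m n (suc a))

mirror-suc-row : ∀ {n a d} → d < n ∸ suc a → mirror n a d ≡ suc (mirror n (suc a) d)
mirror-suc-row {n} {a} {d} lt = trans (mirror-suc lt) (cong suc (sym (mirror-shift n a d)))

valid⇒≤ : ∀ {n a j} → Valid n (suc a) j → j ≤ n ∸ suc a
valid⇒≤ {n} {a} {j} (_ , _ , le) = m+n≤o⇒m≤o∸n j (subst (_≤ n) (+-comm (suc a) j) le)

valid-intro : ∀ {n a j} → 0 < j → j ≤ n ∸ suc a → Valid n (suc a) j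
valid-intro {n} {a} {suc k} _ le =
  s≤s z≤n , s≤s z≤n , subst (_≤ n) (+-comm (suc k) (suc a)) (m<o∸n⇒m+n<o le)

valid-diag : ∀ {n a j} → Valid n (suc (suc a)) j → Valid n (suc a) (suc j)
valid-diag {n} {a} {j} (_ , _ , le) = s≤s z≤n , s≤s z≤n , subst (_≤ n) (sym (+-suc (suc a) j)) le

cell-valid : ∀ {n a c d} → c < mirror n a d → Valid n (suc a) (mirror n a d)
cell-valid {n} {a} {d = d} lt = valid-intro (≤-<-trans z≤n lt) (mirror≤ n a d)

cell-mirror : ∀ {n a j} → Valid n (suc a) j → mirror n a (mirror n a j) ≡ j
cell-mirror v = mirror-involutive (valid⇒≤ v)

Bounded : ℕ → Array → Set
Bounded n x = ∀ i j → Valid n i j → x i j ≤ j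

-- The first component is membership in T_n, in the form given by inT⇔.
Below : ℕ → Array → Triple → Set
Below n x (a , c , d) = c < mirror n a d × c < x (suc a) (mirror n a d)

below? : ∀ n x t → Dec (Below n x t)
below? n x (a , c , d) = (c <? mirror n a d) ×-dec (c <? x (suc a) (mirror n a d))

below⇔<⊓ : ∀ {n x a c d} → Below n x (a , c , d) ⇔ c < x (suc a) (mirror n a d) ⊓ mirror n a d
below⇔<⊓ = mk⇔ (λ (c<m , c<x) → ⊓-glb c<x c<m) (λ lt → m<n⊓o⇒m<o _ _ lt , m<n⊓o⇒m<n _ _ lt)

below-cong : ∀ {n x x′} → (∀ i j → Valid n i j → x i j ≡ x′ i j) →
  ∀ {t} → Below n x t → Below n x′ t
below-cong x≈x′ {a , c , d} (c<m , c<x) = c<m , subst (c <_) (x≈x′ (suc a) _ (cell-valid c<m)) c<x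

module _ {n : ℕ} (x : Array) where

  below-suc : ∀ {a c d} → Below n x (a , suc c , d) → Below n x (a , c , d)
  below-suc (c<m , c<x) = <-trans (n<1+n _) c<m , <-trans (n<1+n _) c<x

  below-cell : ∀ {a c j} → Valid n (suc a) j → c < j → c < x (suc a) j → Below n x (a , c , mirror n a j)
  below-cell {a} {c} v c<j c<x =
    subst (c <_) (sym (cell-mirror v)) c<j , subst (λ k → c < x (suc a) k) (sym (cell-mirror v)) c<x

  cell-below : ∀ {a c j} → Valid n (suc a) j → Below n x (a , c , mirror n a j) → c < x (suc a) j
  cell-below {a} {c} v (_ , c<x) = subst (λ k → c < x (suc a) k) (cell-mirror v) c<x

StepClosed : ℕ → ColorSet → (Triple → Set) → Set
StepClosed n S P = ∀ {u w} → StepT n S u w → P w → P u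

⊑-closed : ∀ {n S} {P : Triple → Set} → StepClosed n S P → ∀ {u w} → u ⊑[ n , S ] w → P w → P u
⊑-closed closed ε            pw = pw
⊑-closed closed (u→v ◅ v⊑w) pw = closed u→v (⊑-closed closed v⊑w pw)

InX⇒stepClosed : ∀ {n S x} → InX n S x → StepClosed n S (Below n x)
InX⇒stepClosed {n} {S} {x} x∈X = closed
  where
  open InX x∈X
  open ≤-Reasoning

  closed : StepClosed n S (Below n x)
  closed (_ , _ , step-g _) bw = below-suc x bw
  closed {a , c , d} (iu , _ , step-r rS) (c<mw , lt) = c<mu , (begin-strict
    c                          <⟨ lt ⟩
    x (suc (suc a)) j          ≤⟨ red rS (suc a) j vw (valid-diag vw) ⟩
    x (suc a) (suc j)          ≡⟨ cong (x (suc a)) (mirror-suc-row (<mirror⇒depth< c<mu)) ⟨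
    x (suc a) (mirror n a d)   ∎)
    where
    c<mu : c < mirror n a d
    c<mu = to (inT⇔ a c d) iu
    j : ℕ
    j = mirror n (suc a) d
    vw : Valid n (suc (suc a)) j
    vw = cell-valid c<mw
  closed {a , c , d} (iu , _ , step-y yS) (c<mw , lt) = c<mu , (begin-strict
    c                          <⟨ lt ⟩
    x (suc a) j                ≤⟨ yellow yS (suc a) j (cell-valid c<mw) (subst (Valid n (suc a)) eq (cell-valid c<mu)) ⟩
    x (suc a) (suc j)          ≡⟨ cong (x (suc a)) eq ⟨
    x (suc a) (mirror n a d)   ∎)
    where
    c<mu : c < mirror n a d
    c<mu = to (inT⇔ a c d) iu
    j : ℕ
    j = mirror n a (suc d)
    eq : mirror n a d ≡ suc j
    eq = mirror-suc (<mirror⇒depth< c<mu)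
  closed {suc a , c , d} (iu , _ , step-b bS) (c<mw , lt) = c<mu , s<s⁻¹ (begin-strict
    suc c                      <⟨ lt ⟩
    x (suc a) (mirror n a d)   ≡⟨ cong (x (suc a)) (mirror-suc-row (<mirror⇒depth< c<mw)) ⟩
    x (suc a) (suc j)          ≤⟨ blue bS (suc a) j (valid-diag vu) vu ⟩
    x (suc (suc a)) j + 1      ≡⟨ +-comm _ 1 ⟩
    suc (x (suc (suc a)) j)    ∎)
    where
    c<mu : c < mirror n (suc a) d
    c<mu = to (inT⇔ (suc a) c d) iu
    j : ℕ
    j = mirror n (suc a) d
    vu : Valid n (suc (suc a)) j
    vu = cell-valid c<mu
  closed {suc a , c , d} (iu , _ , step-o oS) (c<mw , lt) = c<mu , (begin-strict
    c                              <⟨ lt ⟩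
    x (suc a) (mirror n a (suc d)) ≡⟨ cong (x (suc a)) (mirror-shift n a d) ⟨
    x (suc a) j                    ≤⟨ orange oS (suc a) j vw (cell-valid c<mu) ⟩
    x (suc (suc a)) j              ∎)
    where
    c<mu : c < mirror n (suc a) d
    c<mu = to (inT⇔ (suc a) c d) iu
    j : ℕ
    j = mirror n (suc a) d
    vw : Valid n (suc a) j
    vw = subst (Valid n (suc a)) (sym (mirror-shift n a d)) (cell-valid c<mw)
  closed {a , c , suc d} (iu , _ , step-s sS) (c<mw , lt) = c<mu , s<s⁻¹ (begin-strict
    suc c                      <⟨ lt ⟩
    x (suc a) (mirror n a d)   ≡⟨ cong (x (suc a)) eq ⟩
    x (suc a) (suc j)          ≤⟨ silver sS (suc a) j (subst (Valid n (suc a)) eq (cell-valid c<mw)) (cell-valid c<mu) ⟩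
    x (suc a) j + 1            ≡⟨ +-comm _ 1 ⟩
    suc (x (suc a) j)          ∎)
    where
    c<mu : c < mirror n a (suc d)
    c<mu = to (inT⇔ a c (suc d)) iu
    j : ℕ
    j = mirror n a (suc d)
    eq : mirror n a d ≡ suc j
    eq = mirror-suc (<mirror⇒depth< c<mw)

-- Each inequality x_w ≤ x_u (+ 1) comes from stepping a box lying under x_w back
-- into the column over u.
stepClosed⇒InX : ∀ {n S x} → Bounded n x → StepClosed n S (Below n x) → InX n S x
stepClosed⇒InX {n} {S} {x} bound closed = record
  { bound = bound ; orange = orange ; red = red ; yellow = yellow ; blue = blue ; silver = silver }
  where
  back : ∀ {a c d a′ c′ d′} → Step S (a , c , d) (a′ , c′ , d′) →
    c < mirror n a d → Below n x (a′ , c′ , d′) → Below n x (a , c , d)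
  back {a} {c} {d} {a′} {c′} {d′} st c<m bw =
    closed (from (inT⇔ a c d) c<m , from (inT⇔ a′ c′ d′) (proj₁ bw) , st) bw

  atDepth : ∀ {a c d d′} → d ≡ d′ → Below n x (a , c , d) → Below n x (a , c , d′)
  atDepth refl p = p

  c<j : ∀ {i j c} → Valid n i j → c < x i j → c < j
  c<j v lt = <-≤-trans lt (bound _ _ v)

  onCell : ∀ {a c j} → Valid n (suc a) j → c < j → c < mirror n a (mirror n a j)
  onCell {c = c} v lt = subst (c <_) (sym (cell-mirror v)) lt

  orange : o ∈S S → ∀ i j → Valid n i j → Valid n (suc i) j → x i j ≤ x (suc i) j
  orange oS (suc a) j vw vu = lowerSet-⊆⇒≤ λ c lt →
    cell-below x vu (back (step-o oS) (onCell vu (c<j vw lt))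
      (atDepth (mirror-suc-row (valid⇒≤ (valid-diag vu))) (below-cell x vw (c<j vw lt) lt)))

  red : r ∈S S → ∀ i j → Valid n (suc i) j → Valid n i (suc j) → x (suc i) j ≤ x i (suc j)
  red rS (suc a) j vw vu = lowerSet-⊆⇒≤ λ c lt →
    cell-below x vu (back (step-r rS) (onCell vu (m<n⇒m<1+n (c<j vw lt)))
      (atDepth (mirror-shift n a j) (below-cell x vw (c<j vw lt) lt)))

  yellow : y ∈S S → ∀ i j → Valid n i j → Valid n i (suc j) → x i j ≤ x i (suc j)
  yellow yS (suc a) j vw vu = lowerSet-⊆⇒≤ λ c lt →
    cell-below x vu (back (step-y yS) (onCell vu (m<n⇒m<1+n (c<j vw lt)))
      (atDepth (mirror-suc (valid⇒≤ vu)) (below-cell x vw (c<j vw lt) lt)))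

  blue : b ∈S S → ∀ i j → Valid n i (suc j) → Valid n (suc i) j → x i (suc j) ≤ x (suc i) j + 1
  blue bS (suc a) j vw vu = lowerSet-⊆⇒≤+1 λ c lt →
    cell-below x vu (back (step-b bS) (onCell vu (s<s⁻¹ (c<j vw lt)))
      (atDepth (sym (mirror-shift n a j)) (below-cell x vw (c<j vw lt) lt)))

  silver : s ∈S S → ∀ i j → Valid n i (suc j) → Valid n i j → x i (suc j) ≤ x i j + 1
  silver sS (suc a) j vw vu = lowerSet-⊆⇒≤+1 λ c lt →
    cell-below x vu (atDepth (sym eq) (back (step-s sS)
      (subst (c <_) (cong (mirror n a) eq) (onCell vu (s<s⁻¹ (c<j vw lt)))) (below-cell x vw (c<j vw lt) lt)))
    where
    eq : mirror n a j ≡ suc (mirror n a (suc j))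
    eq = mirror-suc (valid⇒≤ vw)

toIdeal : ∀ {n S} (x : Array) → StepClosed n S (Below n x) → Ideal n S
toIdeal {n} x closed = record
  { mem        = λ t → does (below? n x t)
  ; support    = λ { (a , c , d) m → from (inT⇔ a c d) (proj₁ (does⇒ (below? n x _) m)) }
  ; downClosed = λ u w u⊑w m → dec-true (below? n x u) (⊑-closed closed u⊑w (does⇒ (below? n x w) m)) }

-- The height of I over the cell (i , j); the value at i = 0 is never used.
fromIdeal : ∀ {n S} → Ideal n S → Array
fromIdeal {n} I i j = prefixLength (λ c → mem I (pred i , c , mirror n (pred i) j)) j

module _ {n S} (gS : g ∈S S) (I : Ideal n S) where

  mem-suc : ∀ {a c d} → mem I (a , suc c , d) ≡ true → mem I (a , c , d) ≡ true
  mem-suc {a} {c} {d} m = downClosed I _ _ ((inT , support I _ m , step-g gS) ◅ ε) m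
    where
    inT : InT n (a , c , d)
    inT = from (inT⇔ a c d) (<-trans (n<1+n c) (to (inT⇔ a (suc c) d) (support I _ m)))

  fromIdeal-below : ∀ {t} → Below n (fromIdeal I) t ⇔ (mem I t ≡ true)
  fromIdeal-below {a , c , d} = mk⇔
    (λ (c<m , lt) → memAtDepth (involutive c<m) (prefixLength-sound column (mirror n a d) lt))
    (λ m → let c<m = to (inT⇔ a c d) (support I _ m) in
      c<m , prefixLength-complete (λ _ → mem-suc) c<m (memAtDepth (sym (involutive c<m)) m))
    where
    column : ℕ → Bool
    column c′ = mem I (a , c′ , mirror n a (mirror n a d))
    involutive : c < mirror n a d → mirror n a (mirror n a d) ≡ d
    involutive c<m = mirror-involutive (<⇒≤ (<mirror⇒depth< c<m))
    memAtDepth : ∀ {d′ d″} → d′ ≡ d″ → mem I (a , c , d′) ≡ true → mem I (a , c , d″) ≡ true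
    memAtDepth refl m = m

  fromIdeal-inX : InX n S (fromIdeal I)
  fromIdeal-inX = stepClosed⇒InX (λ i j _ → prefixLength-≤ _ j)
    λ u→w bw → from fromIdeal-below (downClosed I _ _ (u→w ◅ ε) (to fromIdeal-below bw))

  toIdeal-fromIdeal : ∀ t → does (below? n (fromIdeal I) t) ≡ mem I t
  toIdeal-fromIdeal t = does≡ (below? n (fromIdeal I) t) fromIdeal-below

fromIdeal-toIdeal : ∀ {n S x} (x∈X : InX n S x) → ∀ i j → Valid n i j →
  fromIdeal (toIdeal {S = S} x (InX⇒stepClosed x∈X)) i j ≡ x i j
fromIdeal-toIdeal {n} {x = x} x∈X (suc a) j v = ≤-antisym
  (lowerSet-⊆⇒≤ λ c lt → cell-below x v (does⇒ (below? n x _) (prefixLength-sound _ j lt)))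
  (lowerSet-⊆⇒≤ λ c lt → let c<j = <-≤-trans lt (InX.bound x∈X _ _ v) in
    prefixLength-complete (λ _ m → dec-true (below? n x _) (below-suc x (does⇒ (below? n x _) m)))
      c<j (dec-true (below? n x _) (below-cell x v c<j lt)))

module _ {n S} {x : Array} (bound : Bounded n x) (closed : StepClosed n S (Below n x)) where
  private
    entry : ℕ → ℕ → ℕ
    entry i j = if does (valid? n i j) then x i j else 0

    entry-valid : ∀ {i j} → Valid n i j → entry i j ≡ x i j
    entry-valid {i} {j} v = cong (if_then x i j else 0) (dec-true (valid? n i j) v)

    entry-invalid : ∀ {i j} → ¬ Valid n i j → entry i j ≡ 0
    entry-invalid {i} {j} nv = cong (if_then x i j else 0) (dec-false (valid? n i j) nv)

    rowSum : ℕ → ℕ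
    rowSum a = sumTo (n ∸ suc a) (λ k → x (suc a) (suc k))

    boxes : ℕ → ℕ → ℕ → ℕ
    boxes a c d = if does (below? n x (a , c , d)) then 1 else 0

    entry-row0 : sumTo (suc n) (entry 0) ≡ 0
    entry-row0 = sumTo-truncate {N = suc n} _ z≤n λ j _ → entry-invalid {0} {j} λ { (() , _) }

    entry-row : ∀ a → sumTo (suc n) (entry (suc a)) ≡ rowSum a
    entry-row a = begin
      sumTo (suc n) (entry (suc a))
        ≡⟨ sumTo-first n _ ⟩
      entry (suc a) 0 + sumTo n (entry (suc a) ∘ suc)
        ≡⟨ cong (_+ sumTo n (entry (suc a) ∘ suc)) (entry-invalid {suc a} {0} λ { (_ , () , _) }) ⟩
      sumTo n (entry (suc a) ∘ suc)
        ≡⟨ sumTo-truncate _ (m∸n≤m n (suc a)) (λ k L≤k → entry-invalid λ v → ≤⇒≯ L≤k (valid⇒≤ v)) ⟩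
      sumTo (n ∸ suc a) (entry (suc a) ∘ suc)
        ≡⟨ sumTo-cong (n ∸ suc a) (λ k k<L → entry-valid (valid-intro z<s k<L)) ⟩
      rowSum a ∎
      where open ≡-Reasoning

    column-size : ∀ a d → sumTo n (λ c → boxes a c d) ≡ x (suc a) (mirror n a d) ⊓ mirror n a d
    column-size a d = trans
      (sumTo-cong n λ c _ → cong (if_then 1 else 0)
        (does-⇔ (below⇔<⊓ {x = x} {a} {c} {d}) (below? n x _) (c <? _)))
      (sumTo-indicator< (≤-trans (m⊓n≤n _ _) (≤-trans (mirror≤ n a d) (m∸n≤m n (suc a)))))

    boxes-row : ∀ a → sumTo n (λ d → sumTo n (λ c → boxes a c d)) ≡ rowSum a
    boxes-row a = begin
      sumTo n (λ d → sumTo n (λ c → boxes a c d))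
        ≡⟨ sumTo-cong n (λ d _ → column-size a d) ⟩
      sumTo n (λ d → height (mirror n a d))
        ≡⟨ sumTo-mirror {n} {a} height (⊓-zeroʳ _) ⟩
      sumTo (n ∸ suc a) (height ∘ suc)
        ≡⟨ sumTo-cong (n ∸ suc a) (λ k k<L → m≤n⇒m⊓n≡m (bound (suc a) (suc k) (valid-intro z<s k<L))) ⟩
      rowSum a ∎
      where
      open ≡-Reasoning
      height : ℕ → ℕ
      height j = x (suc a) j ⊓ j

  weight≡size : weight n x ≡ size (toIdeal x closed)
  weight≡size = begin
    weight n x
      ≡⟨ sumTo-first n _ ⟩
    sumTo (suc n) (entry 0) + sumTo n (λ a → sumTo (suc n) (entry (suc a)))
      ≡⟨ cong₂ _+_ entry-row0 (sumTo-cong n λ a _ → entry-row a) ⟩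
    sumTo n rowSum
      ≡⟨ sumTo-cong n (λ a _ → sym (boxes-row a)) ⟩
    sumTo n (λ a → sumTo n (λ d → sumTo n (λ c → boxes a c d)))
      ≡⟨ sumTo-cong n (λ a _ → sumTo-swap n n λ d c → boxes a c d) ⟩
    size (toIdeal x closed) ∎
    where open ≡-Reasoning

idealOf : ∀ {n S} → X n S → Ideal n S
idealOf (x , x∈X) = toIdeal x (InX⇒stepClosed x∈X)

staircaseInverse : ∀ n S → g ∈S S → Inverse (XSetoid n S) (JSetoid n S)
staircaseInverse n S gS = record
  { to        = idealOf
  ; from      = arrayOf
  ; to-cong   = λ {x} {x′} → to-cong {x} {x′}
  ; from-cong = λ {I} {I′} → from-cong {I} {I′}
  ; inverse   = (λ {I} {x} → inverseˡ {I} {x}) , (λ {x} {I} → inverseʳ {x} {I})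
  }
  where
  arrayOf : Ideal n S → X n S
  arrayOf I = fromIdeal I , fromIdeal-inX gS I

  to-cong : ∀ {x x′ : X n S} → _≈X_ {n} {S} x x′ → idealOf x ≈J idealOf x′
  to-cong {x , _} {x′ , _} x≈x′ t =
    does-⇔ (mk⇔ (below-cong x≈x′) (below-cong λ i j v → sym (x≈x′ i j v))) (below? n x t) (below? n x′ t)

  from-cong : ∀ {I I′ : Ideal n S} → I ≈J I′ → _≈X_ {n} {S} (arrayOf I) (arrayOf I′)
  from-cong I≈I′ i j _ = prefixLength-cong (λ c → I≈I′ _) j

  inverseˡ : ∀ {I x} → _≈X_ {n} {S} x (arrayOf I) → idealOf x ≈J I
  inverseˡ {I} {x} x≈I t = trans (to-cong {x} {arrayOf I} x≈I t) (toIdeal-fromIdeal gS I t)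

  inverseʳ : ∀ {x I} → I ≈J idealOf x → _≈X_ {n} {S} (arrayOf I) x
  inverseʳ {x , x∈X} {I} I≈x i j v =
    trans (from-cong {I} {idealOf (x , x∈X)} I≈x i j v) (fromIdeal-toIdeal x∈X i j v)

proposition2p12 : (n : ℕ) → 1 ≤ n → (S : ColorSet) → Admissible S → g ∈S S →
    Σ (Bijection (XSetoid n S) (JSetoid n S)) λ φ →
      ∀ (x : X n S) → weight n (proj₁ x) ≡ size (Bijection.to φ x)
proposition2p12 n _ S _ gS =
  Inverse⇒Bijection (staircaseInverse n S gS) ,
  λ (x , x∈X) → weight≡size (InX.bound x∈X) (InX⇒stepClosed x∈X)
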